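{- Let $\mathfrak{L}=\langle L,\wedge,\vee,\neg,\top,\bot\rangle$ be a bounded lattice (with meet $\wedge$, join $\vee$, top $\top$, bottom $\bot$) equipped with a unary operation $\neg$, and let $\vDash_{\mathrm{NFL}_{\mathfrak{L}}}$ be the entailment relation of the matrix $\mathrm{NFL}_{\mathfrak{L}}=\langle\mathfrak{L},L\setminus\{\bot\}\rangle$. Then for all formulas $\phi,\chi,\psi$: \begin{enumerate} \item $\phi\vee(\chi\wedge\psi)\vDash_{\mathrm{NFL}_{\mathfrak{L}}}(\phi\vee\chi)\wedge(\phi\vee\psi)$; \item $(\phi\vee\chi)\wedge(\phi\vee\psi)\vDash_{\mathrm{NFL}_{\mathfrak{L}}}\phi\vee(\chi\wedge\psi)$; \item $(\phi\wedge\chi)\vee(\phi\wedge\psi)\vDash_{\mathrm{NFL}_{\mathfrak{L}}}\phi\wedge(\chi\vee\psi)$; \item $\phi\wedge(\chi\vee\psi)\vDash_{\mathrm{NFL}_{\mathfrak{L}}}(\phi\wedge\chi)\vee\psi$; \item $(\phi\vee\chi)\wedge\psi\vDash_{\mathrm{NFL}_{\mathfrak{L}}}\phi\vee(\chi\wedge\psi)$. \end{enumerate}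
   Context: Formulas are built from propositional variables using the connectives $\neg,\wedge,\vee$. A valuation $v$ in $\mathfrak{L}$ assigns an element of $L$ to each propositional variable and is extended to all formulas by interpreting $\neg,\wedge,\vee$ as the corresponding operations of $\mathfrak{L}$. The entailment of the matrix $\mathrm{NFL}_{\mathfrak{L}}=\langle\mathfrak{L},L\setminus\{\bot\}\rangle$ is: $\phi\vDash_{\mathrm{NFL}_{\mathfrak{L}}}\chi$ iff for every valuation $v$, $v(\phi)\neq\bot$ implies $v(\chi)\neq\bot$. -}

module Defs where

open import Level using (Level)
open import Data.Nat using (ℕ)
open import Relation.Nullary using (¬_)
open import Relation.Binary.Lattice.Bundles using (BoundedLattice)

data Formula : Set where
  var  : ℕ → Formula
  ~_   : Formula → Formula
  _∧ᶠ_ : Formula → Formula → Formula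
  _∨ᶠ_ : Formula → Formula → Formula

infix  8 ~_
infixr 7 _∧ᶠ_
infixr 6 _∨ᶠ_

module NFL {c ℓ₁ ℓ₂ : Level} (𝔏 : BoundedLattice c ℓ₁ ℓ₂)
           (neg : BoundedLattice.Carrier 𝔏 → BoundedLattice.Carrier 𝔏) where
  open BoundedLattice 𝔏

  Valuation : Set c
  Valuation = ℕ → Carrier

  eval : Valuation → Formula → Carrier
  eval v (var p)   = v p
  eval v (~ φ)     = neg (eval v φ)
  eval v (φ ∧ᶠ χ)  = eval v φ ∧ eval v χ
  eval v (φ ∨ᶠ χ)  = eval v φ ∨ eval v χ

  _⊨_ : Formula → Formula → Set (c Level.⊔ ℓ₁)
  φ ⊨ χ = (v : Valuation) → ¬ (eval v φ ≈ ⊥) → ¬ (eval v χ ≈ ⊥)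

-- In a bounded lattice a join is ⊥ only if both joinands are, and joining
-- with ⊥ changes nothing. So whenever the conclusion of item 2 or 4
-- evaluates to ⊥, one argument of a join in it is ⊥, and the distributive law
-- that fails in general holds trivially at that valuation. Items 1 and 3 are
-- the distributive inequalities valid in every lattice, and ⊨ contains ≤;
-- item 5 follows from item 2 as (φ ∨ χ) ∧ ψ ≤ (φ ∨ χ) ∧ (φ ∨ ψ).
module Submission where

open import Defs
open import Data.Product using (_×_; _,_)
open import Function using (_∘_)
open import Relation.Nullary using (¬_)
open import Relation.Binary.Lattice.Bundles using (Lattice; BoundedLattice)
import Relation.Binary.Lattice.Properties.MeetSemilattice as MeetProperties
import Relation.Binary.Reasoning.PartialOrder as ≤-Reasoning

module DistributiveInequalities {c ℓ₁ ℓ₂} (L : Lattice c ℓ₁ ℓ₂) where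
  open Lattice L
  open MeetProperties meetSemilattice using (∧-monotonic)

  ∨-distribˡ-∧-≤ : ∀ {x y z} → x ∨ y ∧ z ≤ (x ∨ y) ∧ (x ∨ z)
  ∨-distribˡ-∧-≤ {x} {y} {z} =
    ∨-least (∧-greatest (x≤x∨y x y) (x≤x∨y x z))
            (∧-monotonic (y≤x∨y x y) (y≤x∨y x z))

  ∧-distribˡ-∨-≥ : ∀ {x y z} → x ∧ y ∨ x ∧ z ≤ x ∧ (y ∨ z)
  ∧-distribˡ-∨-≥ {x} {y} {z} =
    ∨-least (∧-monotonic refl (x≤x∨y y z))
            (∧-monotonic refl (y≤x∨y y z))

module BottomProperties {c ℓ₁ ℓ₂} (L : BoundedLattice c ℓ₁ ℓ₂) where
  open BoundedLattice L
  open MeetProperties meetSemilattice using (∧-monotonic)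
  open ≤-Reasoning poset

  ≤⊥⇒≈⊥ : ∀ {x} → x ≤ ⊥ → x ≈ ⊥
  ≤⊥⇒≈⊥ {x} x≤⊥ = antisym x≤⊥ (minimum x)

  ≤⊥-contraposition : ∀ {x y} → (y ≤ ⊥ → x ≤ ⊥) → ¬ x ≈ ⊥ → ¬ y ≈ ⊥
  ≤⊥-contraposition y≤⊥⇒x≤⊥ x≉⊥ y≈⊥ = x≉⊥ (≤⊥⇒≈⊥ (y≤⊥⇒x≤⊥ (reflexive y≈⊥)))

  ≉⊥-mono : ∀ {x y} → x ≤ y → ¬ x ≈ ⊥ → ¬ y ≈ ⊥
  ≉⊥-mono x≤y = ≤⊥-contraposition (trans x≤y)

  x≤⊥⇒x∨y≤y : ∀ {x y} → x ≤ ⊥ → x ∨ y ≤ y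
  x≤⊥⇒x∨y≤y {y = y} x≤⊥ = ∨-least (trans x≤⊥ (minimum y)) refl

  y≤⊥⇒x∨y≤x : ∀ {x y} → y ≤ ⊥ → x ∨ y ≤ x
  y≤⊥⇒x∨y≤x {x} y≤⊥ = ∨-least refl (trans y≤⊥ (minimum x))

  x∨y∧z≤⊥⇒[x∨y]∧[x∨z]≤⊥ : ∀ {x y z} → x ∨ y ∧ z ≤ ⊥ → (x ∨ y) ∧ (x ∨ z) ≤ ⊥
  x∨y∧z≤⊥⇒[x∨y]∧[x∨z]≤⊥ {x} {y} {z} x∨y∧z≤⊥ = begin
    (x ∨ y) ∧ (x ∨ z)  ≤⟨ ∧-monotonic (x≤⊥⇒x∨y≤y x≤⊥) (x≤⊥⇒x∨y≤y x≤⊥) ⟩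
    y ∧ z              ≤⟨ y≤x∨y x (y ∧ z) ⟩
    x ∨ y ∧ z          ≤⟨ x∨y∧z≤⊥ ⟩
    ⊥                  ∎
    where
    x≤⊥ : x ≤ ⊥
    x≤⊥ = trans (x≤x∨y x (y ∧ z)) x∨y∧z≤⊥

  x∧y∨z≤⊥⇒x∧[y∨z]≤⊥ : ∀ {x y z} → x ∧ y ∨ z ≤ ⊥ → x ∧ (y ∨ z) ≤ ⊥
  x∧y∨z≤⊥⇒x∧[y∨z]≤⊥ {x} {y} {z} x∧y∨z≤⊥ = begin
    x ∧ (y ∨ z)  ≤⟨ ∧-monotonic refl (y≤⊥⇒x∨y≤x z≤⊥) ⟩
    x ∧ y        ≤⟨ x≤x∨y (x ∧ y) z ⟩
    x ∧ y ∨ z    ≤⟨ x∧y∨z≤⊥ ⟩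
    ⊥            ∎
    where
    z≤⊥ : z ≤ ⊥
    z≤⊥ = trans (y≤x∨y (x ∧ y) z) x∧y∨z≤⊥

module NFLProperties {c ℓ₁ ℓ₂} (𝔏 : BoundedLattice c ℓ₁ ℓ₂)
                     (neg : BoundedLattice.Carrier 𝔏 → BoundedLattice.Carrier 𝔏) where
  open BoundedLattice 𝔏
  open MeetProperties meetSemilattice using (∧-monotonic)
  open DistributiveInequalities lattice
  open BottomProperties 𝔏
  open NFL 𝔏 neg

  ∨-distribˡ-∧-⊨ : ∀ φ χ ψ → (φ ∨ᶠ χ ∧ᶠ ψ) ⊨ ((φ ∨ᶠ χ) ∧ᶠ (φ ∨ᶠ ψ))
  ∨-distribˡ-∧-⊨ _ _ _ _ = ≉⊥-mono ∨-distribˡ-∧-≤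

  ∨-distribˡ-∧-⊨⁻ : ∀ φ χ ψ → ((φ ∨ᶠ χ) ∧ᶠ (φ ∨ᶠ ψ)) ⊨ (φ ∨ᶠ χ ∧ᶠ ψ)
  ∨-distribˡ-∧-⊨⁻ _ _ _ _ = ≤⊥-contraposition x∨y∧z≤⊥⇒[x∨y]∧[x∨z]≤⊥

  ∧-distribˡ-∨-⊨⁻ : ∀ φ χ ψ → (φ ∧ᶠ χ ∨ᶠ φ ∧ᶠ ψ) ⊨ (φ ∧ᶠ (χ ∨ᶠ ψ))
  ∧-distribˡ-∨-⊨⁻ _ _ _ _ = ≉⊥-mono ∧-distribˡ-∨-≥

  ∧-∨-modular-⊨ : ∀ φ χ ψ → (φ ∧ᶠ (χ ∨ᶠ ψ)) ⊨ (φ ∧ᶠ χ ∨ᶠ ψ)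
  ∧-∨-modular-⊨ _ _ _ _ = ≤⊥-contraposition x∧y∨z≤⊥⇒x∧[y∨z]≤⊥

  ∨-∧-modular-⊨ : ∀ φ χ ψ → ((φ ∨ᶠ χ) ∧ᶠ ψ) ⊨ (φ ∨ᶠ χ ∧ᶠ ψ)
  ∨-∧-modular-⊨ φ χ ψ v =
    ∨-distribˡ-∧-⊨⁻ φ χ ψ v ∘ ≉⊥-mono (∧-monotonic refl (y≤x∨y (eval v φ) (eval v ψ)))

lemma2 : ∀ {c ℓ₁ ℓ₂} (𝔏 : BoundedLattice c ℓ₁ ℓ₂)
           (neg : BoundedLattice.Carrier 𝔏 → BoundedLattice.Carrier 𝔏) →
           let open NFL 𝔏 neg in
           ∀ (φ χ ψ : Formula) →
           ((φ ∨ᶠ (χ ∧ᶠ ψ)) ⊨ ((φ ∨ᶠ χ) ∧ᶠ (φ ∨ᶠ ψ)))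
           × (((φ ∨ᶠ χ) ∧ᶠ (φ ∨ᶠ ψ)) ⊨ (φ ∨ᶠ (χ ∧ᶠ ψ)))
           × (((φ ∧ᶠ χ) ∨ᶠ (φ ∧ᶠ ψ)) ⊨ (φ ∧ᶠ (χ ∨ᶠ ψ)))
           × ((φ ∧ᶠ (χ ∨ᶠ ψ)) ⊨ ((φ ∧ᶠ χ) ∨ᶠ ψ))
           × (((φ ∨ᶠ χ) ∧ᶠ ψ) ⊨ (φ ∨ᶠ (χ ∧ᶠ ψ)))
lemma2 𝔏 neg φ χ ψ =
    ∨-distribˡ-∧-⊨ φ χ ψ
  , ∨-distribˡ-∧-⊨⁻ φ χ ψ
  , ∧-distribˡ-∨-⊨⁻ φ χ ψ
  , ∧-∨-modular-⊨ φ χ ψ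
  , ∨-∧-modular-⊨ φ χ ψ
  where open NFLProperties 𝔏 neg
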